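{- For all integers $s\ge2$ and $m\ge 1$, $N^s_{s+1}(m)\le\binom{m-2}{s-1}$; in particular $N^s_{s+1}(m)=O(m^{s-1})$.
   Context: An $\mathrm{ADS}^s_k(m)$-sequence is a sequence that is a concatenation of $m$ blocks, each block containing only distinct symbols, in which every symbol appears at least $k$ times, and which contains no (not necessarily contiguous) alternation $a\,b\,a\,b\ldots$ of length $s+2$ with $a\ne b$ (adjacent equal symbols at block interfaces are allowed). $N^s_k(m)$ is the maximum number of distinct symbols in an $\mathrm{ADS}^s_k(m)$-sequence. The binomial coefficient $\binom{a}{b}$ is $0$ when $a<b$. -}

module Defs where

open import Data.Nat using (ℕ; zero; suc; _≤_; _+_)
open import Data.Nat.Properties using (_≟_)
open import Data.List using (List; []; _∷_; length; filter; concat; deduplicate)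
open import Data.List.Membership.Propositional using (_∈_)
open import Data.List.Relation.Unary.Unique.Propositional using (Unique)
open import Data.List.Relation.Unary.All using (All)
open import Data.List.Relation.Binary.Sublist.Propositional using (_⊆_)
open import Relation.Binary.PropositionalEquality using (_≢_; _≡_)
open import Relation.Nullary using (¬_)
open import Data.Product using (_×_)

occ : ℕ → List ℕ → ℕ
occ x w = length (filter (x ≟_) w)

alt : ℕ → ℕ → ℕ → List ℕ
alt a b zero    = []
alt a b (suc n) = a ∷ alt b a n

AltFree : ℕ → List ℕ → Set
AltFree n w = ∀ a b → a ≢ b → ¬ (alt a b n ⊆ w)

distinct : List ℕ → ℕ
distinct w = length (deduplicate _≟_ w)

record ADS (s k m : ℕ) (blocks : List (List ℕ)) : Set where
  field
    nBlocks   : length blocks ≡ m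
    blocksDistinct : All Unique blocks
    kOccur    : ∀ x → x ∈ concat blocks → k ≤ occ x (concat blocks)
    altFree   : AltFree (s + 2) (concat blocks)

module Submission where

-- Number the m blocks 0, …, m-1 and let pos(x) be the increasing list of the
-- indices of the blocks containing the symbol x.  Blocks have distinct
-- symbols, so |pos(x)| ≥ occ x ≥ s+1 and pos(x) = p ∷ W(x) ++ r ∷ R, where
-- the window W(x) holds the 2nd to s-th entries: s-1 indices strictly between
-- p ≥ 0 and r ≤ m-1, i.e. an (s-1)-subset of {1, …, m-2}.
-- If distinct symbols a, b had the same window t₁ < … < t_{s-1}, then taking
-- a and b from their first blocks (in a suitable order), one of them from each
-- shared block tᵢ, and one more from the block after the window gives an
-- alternation of length s+2, which is forbidden.  So x ↦ W(x) is injective,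
-- and there are at most (m-2) C (s-1) symbols.

open import Defs
open import Data.Nat using (ℕ; zero; suc; _≤_; _<_; _+_; _∸_; z≤n; s≤s)
open import Data.Nat.Properties
  using (_≟_; ≤-refl; ≤-trans; ≤-reflexive; n≤1+n; n<1+n; <-trans; <⇒≢; <⇒≱;
         ≤∧≢⇒<; m≤m+n; +-mono-≤; +-suc; +-comm; +-identityʳ; ∸-monoˡ-≤;
         suc-injective; module ≤-Reasoning)
open import Data.Nat.Combinatorics using (_C_; nCk+nC[k+1]≡[n+1]C[k+1])
open import Data.List using (List; []; _∷_; length; concat; _++_; filter; take; drop; map; deduplicate)
open import Data.List.Properties
  using (∷-injectiveˡ; ∷-injectiveʳ; length-++; length-map; filter-++; filter-none; filter-accept; filter-reject)
open import Data.List.Membership.Propositional using (_∈_; _∉_)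
open import Data.List.Membership.DecPropositional _≟_ using (_∈?_)
open import Data.List.Membership.Propositional.Properties using (∈-++⁺ˡ; ∈-++⁺ʳ; ∈-deduplicate⁻)
open import Data.List.Relation.Unary.Any using (here; there)
open import Data.List.Relation.Unary.All as All using (All; []; _∷_)
open import Data.List.Relation.Unary.All.Properties using (¬Any⇒All¬; ++⁻ʳ; map⁺)
open import Data.List.Relation.Unary.AllPairs using ([]; _∷_)
open import Data.List.Relation.Unary.Unique.Propositional using (Unique)
open import Data.List.Relation.Unary.Unique.DecPropositional.Properties _≟_ using (deduplicate-!)
open import Data.List.Relation.Binary.Sublist.Propositional using (_⊆_; _∷_; _∷ʳ_; minimum; from∈)
open import Data.List.Relation.Binary.Sublist.Propositional.Properties using (++⁺)
open import Data.Product using (Σ; _×_; _,_; proj₁; proj₂)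
open import Data.Sum as Sum using (_⊎_; inj₁; inj₂; [_,_]′)
open import Data.Unit using (⊤; tt)
open import Data.Empty using (⊥-elim)
open import Function using (_∘_)
open import Relation.Nullary using (yes; no)
open import Relation.Binary.PropositionalEquality using (_≡_; _≢_; refl; sym; trans; cong; subst)

pick : ∀ {x : ℕ} {X ys Z} → x ∈ X → ys ⊆ Z → (x ∷ ys) ⊆ X ++ Z
pick x∈X ys⊆Z = ++⁺ (from∈ x∈X) ys⊆Z

skip : ∀ (X : List ℕ) {ys Z : List ℕ} → ys ⊆ Z → ys ⊆ X ++ Z
skip X = ++⁺ (minimum X)

ordered-pair : ∀ {a b : ℕ} {X} → a ∈ X → b ∈ X → a ≢ b →
  (a ∷ b ∷ []) ⊆ X ⊎ (b ∷ a ∷ []) ⊆ X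
ordered-pair (here refl) (here refl) a≢b = ⊥-elim (a≢b refl)
ordered-pair (here refl) (there b∈X) _ = inj₁ (refl ∷ from∈ b∈X)
ordered-pair (there a∈X) (here refl) _ = inj₂ (refl ∷ from∈ a∈X)
ordered-pair {X = y ∷ X} (there a∈X) (there b∈X) a≢b =
  Sum.map (y ∷ʳ_) (y ∷ʳ_) (ordered-pair a∈X b∈X a≢b)

data IncFrom : ℕ → List ℕ → Set where
  []  : ∀ {lo} → IncFrom lo []
  _∷_ : ∀ {lo x xs} → lo ≤ x → IncFrom (suc x) xs → IncFrom lo (x ∷ xs)

inc-weaken : ∀ {lo lo′ xs} → lo′ ≤ lo → IncFrom lo xs → IncFrom lo′ xs
inc-weaken _ [] = []
inc-weaken lo′≤lo (lo≤x ∷ inc) = ≤-trans lo′≤lo lo≤x ∷ inc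

inc-tail : ∀ {lo x xs} → IncFrom lo (x ∷ xs) → IncFrom (suc x) xs
inc-tail (_ ∷ inc) = inc

inc-prefix : ∀ {lo} T {R} → IncFrom lo (T ++ R) → IncFrom lo T
inc-prefix [] _ = []
inc-prefix (t ∷ T) (lo≤t ∷ inc) = lo≤t ∷ inc-prefix T inc

inc-lower : ∀ {lo} T {r R} → IncFrom lo (T ++ r ∷ R) → lo ≤ r
inc-lower [] (lo≤r ∷ _) = lo≤r
inc-lower (t ∷ T) (lo≤t ∷ inc) = ≤-trans lo≤t (≤-trans (n≤1+n t) (inc-lower T inc))

inc-below : ∀ {lo} T {r R} → IncFrom lo (T ++ r ∷ R) → All (_< r) T
inc-below [] _ = []
inc-below (t ∷ T) (_ ∷ inc) = inc-lower T inc ∷ inc-below T (inc-weaken (n≤1+n t) inc)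

positions : ℕ → ℕ → List (List ℕ) → List ℕ
positions x i [] = []
positions x i (X ∷ B) with x ∈? X
... | yes _ = i ∷ positions x (suc i) B
... | no _  = positions x (suc i) B

positions-inc : ∀ x i B → IncFrom i (positions x i B)
positions-inc x i [] = []
positions-inc x i (X ∷ B) with x ∈? X
... | yes _ = ≤-refl ∷ positions-inc x (suc i) B
... | no _  = inc-weaken (n≤1+n i) (positions-inc x (suc i) B)

positions-bound : ∀ x i B {hi} → i + length B ≤ hi → All (_< hi) (positions x i B)
positions-bound x i [] _ = []
positions-bound x i (X ∷ B) {hi} i+|XB|≤hi with x ∈? X
... | yes _ = ≤-trans (s≤s (m≤m+n i (length B))) i+1+|B|≤hi
              ∷ positions-bound x (suc i) B i+1+|B|≤hi
  where i+1+|B|≤hi : suc i + length B ≤ hi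
        i+1+|B|≤hi = subst (_≤ hi) (+-suc i (length B)) i+|XB|≤hi
... | no _  = positions-bound x (suc i) B (subst (_≤ hi) (+-suc i (length B)) i+|XB|≤hi)

positions-member : ∀ x i B {p R} → positions x i B ≡ p ∷ R → x ∈ concat B
positions-member x i (X ∷ B) e with x ∈? X
... | yes x∈X = ∈-++⁺ˡ x∈X
... | no _    = ∈-++⁺ʳ X (positions-member x (suc i) B e)

first-above : ∀ x i B {p R} → positions x i B ≡ p ∷ R → i ≤ p
first-above x i B e with subst (IncFrom i) e (positions-inc x i B)
... | i≤p ∷ _ = i≤p

second-above : ∀ x i B {p q R} → positions x i B ≡ p ∷ q ∷ R → i < q
second-above x i B e with subst (IncFrom i) e (positions-inc x i B)
... | i≤p ∷ p<q ∷ _ = ≤-trans (s≤s i≤p) p<q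

occ-++ : ∀ x X Y → occ x (X ++ Y) ≡ occ x X + occ x Y
occ-++ x X Y = trans (cong length (filter-++ (x ≟_) X Y)) (length-++ (filter (x ≟_) X))

occ-absent : ∀ {x X} → x ∉ X → occ x X ≡ 0
occ-absent {x} {X} x∉X = cong length (filter-none (x ≟_) (¬Any⇒All¬ X x∉X))

occ-unique : ∀ x {X} → Unique X → occ x X ≤ 1
occ-unique x [] = z≤n
occ-unique x {y ∷ X} (y∉X ∷ uniq) with x ≟ y
... | yes refl = ≤-reflexive (cong length (trans (filter-accept (x ≟_) refl)
                   (cong (x ∷_) (filter-none (x ≟_) y∉X))))
... | no x≢y  = subst (_≤ 1) (sym (cong length (filter-reject (x ≟_) x≢y))) (occ-unique x uniq)

-- A symbol occurs at most once per block, so its number of occurrences is at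
-- most its number of positions.
occ-≤-positions : ∀ x i B → All Unique B → occ x (concat B) ≤ length (positions x i B)
occ-≤-positions x i [] _ = z≤n
occ-≤-positions x i (X ∷ B) (uniq ∷ uniqs) rewrite occ-++ x X (concat B) with x ∈? X
... | yes _   = +-mono-≤ (occ-unique x uniq) (occ-≤-positions x (suc i) B uniqs)
... | no x∉X rewrite occ-absent x∉X = occ-≤-positions x (suc i) B uniqs

shared-alternation : ∀ a b i B T {ra rb Ra Rb} →
  positions a i B ≡ T ++ ra ∷ Ra → positions b i B ≡ T ++ rb ∷ Rb →
  alt a b (suc (length T)) ⊆ concat B
shared-alternation a b i B [] ea _ = from∈ (positions-member a i B ea)
shared-alternation a b i [] (t ∷ T) () _
shared-alternation a b i (X ∷ B) (t ∷ T) ea eb with a ∈? X | b ∈? X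
... | yes a∈X | yes _ =
  pick a∈X (shared-alternation b a (suc i) B T (∷-injectiveʳ eb) (∷-injectiveʳ ea))
... | yes _ | no _  = ⊥-elim (<⇒≢ (first-above b (suc i) B eb) (∷-injectiveˡ ea))
... | no _  | yes _ = ⊥-elim (<⇒≢ (first-above a (suc i) B ea) (∷-injectiveˡ eb))
... | no _  | no _  = skip X (shared-alternation a b (suc i) B (t ∷ T) ea eb)

lead-alternation : ∀ a b i B t T {q ra rb Ra Rb} →
  positions a i B ≡ (t ∷ T) ++ ra ∷ Ra → positions b i B ≡ q ∷ (t ∷ T) ++ rb ∷ Rb →
  alt b a (suc (suc (length (t ∷ T)))) ⊆ concat B
lead-alternation a b i [] t T () _
lead-alternation a b i (X ∷ B) t T ea eb with a ∈? X | b ∈? X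
... | yes _ | yes _ = ⊥-elim (<⇒≢ (first-above b (suc i) B (∷-injectiveʳ eb)) (∷-injectiveˡ ea))
... | yes _ | no _  = ⊥-elim (<⇒≢ (<-trans (n<1+n i) (second-above b (suc i) B eb)) (∷-injectiveˡ ea))
... | no _  | yes b∈X =
  pick b∈X (shared-alternation a b (suc i) B (t ∷ T) ea (∷-injectiveʳ eb))
... | no _  | no _  = skip X (lead-alternation a b (suc i) B t T ea eb)

window-alternation : ∀ a b i B T {p q ra rb Ra Rb} → 0 < length T → a ≢ b →
  positions a i B ≡ p ∷ T ++ ra ∷ Ra → positions b i B ≡ q ∷ T ++ rb ∷ Rb →
  alt a b (3 + length T) ⊆ concat B ⊎ alt b a (3 + length T) ⊆ concat B
window-alternation a b i B [] () _ _ _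
window-alternation a b i [] (t ∷ T) _ _ () _
window-alternation a b i (X ∷ B) (t ∷ T) T≢[] a≢b ea eb with a ∈? X | b ∈? X
... | yes a∈X | yes b∈X =
  Sum.map (λ ab⊆X → ++⁺ ab⊆X (shared-alternation a b (suc i) B (t ∷ T) ea′ eb′))
          (λ ba⊆X → ++⁺ ba⊆X (shared-alternation b a (suc i) B (t ∷ T) eb′ ea′))
          (ordered-pair a∈X b∈X a≢b)
  where ea′ : positions a (suc i) B ≡ (t ∷ T) ++ _ ∷ _
        ea′ = ∷-injectiveʳ ea
        eb′ : positions b (suc i) B ≡ (t ∷ T) ++ _ ∷ _
        eb′ = ∷-injectiveʳ eb
... | yes a∈X | no _ = inj₁ (pick a∈X (lead-alternation a b (suc i) B t T (∷-injectiveʳ ea) eb))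
... | no _ | yes b∈X = inj₂ (pick b∈X (lead-alternation b a (suc i) B t T (∷-injectiveʳ eb) ea))
... | no _ | no _ = Sum.map (skip X) (skip X) (window-alternation a b (suc i) B (t ∷ T) T≢[] a≢b ea eb)

-- Increasing k lo n xs: xs lists, in increasing order, a k-element subset of
-- the interval [lo, lo + n).
Increasing : ℕ → ℕ → ℕ → List ℕ → Set
Increasing k lo n xs = IncFrom lo xs × length xs ≡ k × All (_< lo + n) xs

tails-from : ℕ → List (List ℕ) → List (List ℕ)
tails-from lo [] = []
tails-from lo ([] ∷ L) = tails-from lo L
tails-from lo ((x ∷ xs) ∷ L) with x ≟ lo
... | yes _ = xs ∷ tails-from lo L
... | no _  = tails-from lo L

others : ℕ → List (List ℕ) → List (List ℕ)
others lo [] = []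
others lo ([] ∷ L) = [] ∷ others lo L
others lo ((x ∷ xs) ∷ L) with x ≟ lo
... | yes _ = others lo L
... | no _  = (x ∷ xs) ∷ others lo L

HeadNot : ℕ → List ℕ → Set
HeadNot lo [] = ⊤
HeadNot lo (x ∷ _) = x ≢ lo

length-split : ∀ lo L → length L ≡ length (tails-from lo L) + length (others lo L)
length-split lo [] = refl
length-split lo ([] ∷ L) = trans (cong suc (length-split lo L)) (sym (+-suc _ _))
length-split lo ((x ∷ xs) ∷ L) with x ≟ lo
... | yes _ = cong suc (length-split lo L)
... | no _  = trans (cong suc (length-split lo L)) (sym (+-suc _ _))

tails-from-All : ∀ {P : List ℕ → Set} lo L → All P L → All (P ∘ (lo ∷_)) (tails-from lo L)
tails-from-All lo [] [] = []
tails-from-All lo ([] ∷ L) (_ ∷ ps) = tails-from-All lo L ps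
tails-from-All lo ((x ∷ xs) ∷ L) (p ∷ ps) with x ≟ lo
... | yes refl = p ∷ tails-from-All lo L ps
... | no _     = tails-from-All lo L ps

others-All : ∀ {P : List ℕ → Set} lo L → All P L → All (λ xs → P xs × HeadNot lo xs) (others lo L)
others-All lo [] [] = []
others-All lo ([] ∷ L) (p ∷ ps) = (p , tt) ∷ others-All lo L ps
others-All lo ((x ∷ xs) ∷ L) (p ∷ ps) with x ≟ lo
... | yes _   = others-All lo L ps
... | no x≢lo = (p , x≢lo) ∷ others-All lo L ps

tails-from-Unique : ∀ lo L → Unique L → Unique (tails-from lo L)
tails-from-Unique lo [] _ = []
tails-from-Unique lo ([] ∷ L) (_ ∷ uniq) = tails-from-Unique lo L uniq
tails-from-Unique lo ((x ∷ xs) ∷ L) (fresh ∷ uniq) with x ≟ lo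
... | yes refl = All.map (λ ne e → ne (cong (x ∷_) e)) (tails-from-All lo L fresh)
                 ∷ tails-from-Unique lo L uniq
... | no _     = tails-from-Unique lo L uniq

others-Unique : ∀ lo L → Unique L → Unique (others lo L)
others-Unique lo [] _ = []
others-Unique lo ([] ∷ L) (fresh ∷ uniq) = All.map proj₁ (others-All lo L fresh) ∷ others-Unique lo L uniq
others-Unique lo ((x ∷ xs) ∷ L) (fresh ∷ uniq) with x ≟ lo
... | yes _ = others-Unique lo L uniq
... | no _  = All.map proj₁ (others-All lo L fresh) ∷ others-Unique lo L uniq

at-most-one-empty : ∀ (L : List (List ℕ)) → All (λ xs → length xs ≡ 0) L → Unique L → length L ≤ 1
at-most-one-empty [] _ _ = z≤n
at-most-one-empty ([] ∷ []) _ _ = s≤s z≤n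
at-most-one-empty ([] ∷ [] ∷ L) _ ((ne ∷ _) ∷ _) = ⊥-elim (ne refl)
at-most-one-empty ([] ∷ (_ ∷ _) ∷ L) (_ ∷ () ∷ _) _
at-most-one-empty ((_ ∷ _) ∷ L) (() ∷ _) _

nC0≡1 : ∀ n → n C 0 ≡ 1
nC0≡1 zero = refl
nC0≡1 (suc n) = refl

-- There are at most n C k increasing lists of length k in an interval of
-- length n: those starting with lo are counted by n-1 C k-1, the others by
-- n-1 C k (Pascal's rule).
count-increasing : ∀ n k lo (L : List (List ℕ)) → Unique L → All (Increasing k lo n) L →
  length L ≤ n C k
count-increasing n zero lo L uniq incs =
  subst (length L ≤_) (sym (nC0≡1 n)) (at-most-one-empty L (All.map (proj₁ ∘ proj₂) incs) uniq)
count-increasing zero (suc k) lo [] _ _ = z≤n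
count-increasing zero (suc k) lo ([] ∷ L) _ ((_ , () , _) ∷ _)
count-increasing zero (suc k) lo ((x ∷ xs) ∷ L) _ ((lo≤x ∷ _ , _ , x<lo+0 ∷ _) ∷ _) =
  ⊥-elim (<⇒≱ (subst (x <_) (+-identityʳ lo) x<lo+0) lo≤x)
count-increasing (suc n) (suc k) lo L uniq incs = begin
  length L
    ≡⟨ length-split lo L ⟩
  length (tails-from lo L) + length (others lo L)
    ≤⟨ +-mono-≤ (count-increasing n k (suc lo) (tails-from lo L) (tails-from-Unique lo L uniq)
                   (All.map drop-lo (tails-from-All lo L incs)))
                (count-increasing n (suc k) (suc lo) (others lo L) (others-Unique lo L uniq)
                   (All.map raise-lo (others-All lo L incs))) ⟩
  n C k + n C suc k
    ≡⟨ nCk+nC[k+1]≡[n+1]C[k+1] n k ⟩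
  suc n C suc k ∎
  where
  open ≤-Reasoning
  shift : ∀ {ys} → All (_< lo + suc n) ys → All (_< suc lo + n) ys
  shift = All.map (λ {z} → subst (z <_) (+-suc lo n))
  drop-lo : ∀ {ys} → Increasing (suc k) lo (suc n) (lo ∷ ys) → Increasing k (suc lo) n ys
  drop-lo (_ ∷ inc , len , _ ∷ bounds) = inc , suc-injective len , shift bounds
  raise-lo : ∀ {xs} → Increasing (suc k) lo (suc n) xs × HeadNot lo xs → Increasing (suc k) (suc lo) n xs
  raise-lo {[]} ((_ , () , _) , _)
  raise-lo {x ∷ xs} ((lo≤x ∷ inc , len , bounds) , x≢lo) =
    ≤∧≢⇒< lo≤x (x≢lo ∘ sym) ∷ inc , len , shift bounds

map-unique-on : ∀ {A B : Set} (f : A → B) {U : List A} →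
  (∀ {x y} → x ∈ U → y ∈ U → x ≢ y → f x ≢ f y) → Unique U → Unique (map f U)
map-unique-on f {[]} _ [] = []
map-unique-on f {u ∷ U} inj (u∉U ∷ uniq) =
  map⁺ (All.tabulate λ v∈U → inj (here refl) (there v∈U) (All.lookup u∉U v∈U))
  ∷ map-unique-on f (λ x∈U y∈U → inj (there x∈U) (there y∈U)) uniq

window : ℕ → List ℕ → List ℕ
window k P = take k (drop 1 P)

record Framed (k : ℕ) (P : List ℕ) : Set where
  field
    first next    : ℕ
    rest          : List ℕ
    shape         : P ≡ first ∷ window k P ++ next ∷ rest
    window-length : length (window k P) ≡ k

take-split : ∀ k P → suc k ≤ length P →
  Σ ℕ λ r → Σ (List ℕ) λ R → P ≡ take k P ++ r ∷ R × length (take k P) ≡ k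
take-split zero (r ∷ R) _ = r , R , refl , refl
take-split (suc k) (x ∷ P) (s≤s k<|P|) =
  let r , R , P≡ , len = take-split k P k<|P| in r , R , cong (x ∷_) P≡ , cong suc len

framed : ∀ k P → suc (suc k) ≤ length P → Framed k P
framed k (p ∷ P) (s≤s k<|P|) =
  let r , R , P≡ , len = take-split k P k<|P| in
  record { first = p ; next = r ; rest = R ; shape = cong (p ∷_) P≡ ; window-length = len }

-- In a sequence of m blocks the window of a symbol lies strictly between its
-- first position ≥ 0 and a later position < m, so it is an increasing list of
-- k indices from [1, m-1).
window-increasing : ∀ {k x} B {m} → length B ≡ m → Framed k (positions x 0 B) →
  Increasing k 1 (m ∸ 2) (window k (positions x 0 B))
window-increasing {k} {x} B refl fr =
  inc-prefix T (inc-weaken (s≤s z≤n) after-first) ,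
  window-length ,
  All.map (λ t<next → inner t<next next<m) (inc-below T after-first)
  where
  open Framed fr
  T : List ℕ
  T = window k (positions x 0 B)
  after-first : IncFrom (suc first) (T ++ next ∷ rest)
  after-first = inc-tail (subst (IncFrom 0) shape (positions-inc x 0 B))
  next<m : next < length B
  next<m = All.head (++⁻ʳ T (All.tail (subst (All (_< length B)) shape (positions-bound x 0 B ≤-refl))))
  inner : ∀ {t r m} → t < r → r < m → t < suc (m ∸ 2)
  inner t<r r<m = s≤s (∸-monoˡ-≤ 2 (≤-trans (s≤s t<r) r<m))

window-injective : ∀ {k a b} B → 0 < k → AltFree (3 + k) (concat B) → a ≢ b →
  Framed k (positions a 0 B) → Framed k (positions b 0 B) →
  window k (positions a 0 B) ≢ window k (positions b 0 B)
window-injective {k} {a} {b} B 0<k free a≢b fa fb same =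
  [ free′ a b a≢b , free′ b a (a≢b ∘ sym) ]′
    (window-alternation a b 0 B T (subst (0 <_) (sym window-length) 0<k) a≢b shape shape-b)
  where
  open Framed fa
  T : List ℕ
  T = window k (positions a 0 B)
  free′ : AltFree (3 + length T) (concat B)
  free′ = subst (λ n → AltFree (3 + n) (concat B)) (sym window-length) free
  shape-b : positions b 0 B ≡ Framed.first fb ∷ T ++ Framed.next fb ∷ Framed.rest fb
  shape-b = trans (Framed.shape fb)
    (cong (λ W → Framed.first fb ∷ W ++ Framed.next fb ∷ Framed.rest fb) (sym same))

lemma4p4 : (s m : ℕ) → 2 ≤ s → 1 ≤ m →
    (blocks : List (List ℕ)) → ADS s (s + 1) m blocks →
    distinct (concat blocks) ≤ (m ∸ 2) C (s ∸ 1)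
lemma4p4 (suc (suc s′)) m (s≤s (s≤s z≤n)) _ B ads = begin
  distinct cs                  ≡⟨ sym (length-map window-of U) ⟩
  length (map window-of U)     ≤⟨ count-increasing (m ∸ 2) (suc s′) 1 (map window-of U)
                                    (map-unique-on window-of distinct-windows (deduplicate-! cs))
                                    (map⁺ (All.tabulate (window-increasing B nBlocks ∘ framed-symbol))) ⟩
  (m ∸ 2) C suc s′             ∎
  where
  open ADS ads
  open ≤-Reasoning
  cs : List ℕ
  cs = concat B
  U : List ℕ
  U = deduplicate _≟_ cs
  window-of : ℕ → List ℕ
  window-of x = window (suc s′) (positions x 0 B)
  -- each symbol occurs at least s′+3 times, hence in at least s′+3 blocks
  framed-symbol : ∀ {x} → x ∈ U → Framed (suc s′) (positions x 0 B)
  framed-symbol {x} x∈U = framed (suc s′) (positions x 0 B)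
    (≤-trans (≤-reflexive (cong (suc ∘ suc) (+-comm 1 s′)))
      (≤-trans (kOccur x (∈-deduplicate⁻ _≟_ cs x∈U)) (occ-≤-positions x 0 B blocksDistinct)))
  distinct-windows : ∀ {x y} → x ∈ U → y ∈ U → x ≢ y → window-of x ≢ window-of y
  distinct-windows x∈U y∈U x≢y =
    window-injective B (s≤s z≤n) (subst (λ n → AltFree n cs) (+-comm (suc (suc s′)) 2) altFree)
      x≢y (framed-symbol x∈U) (framed-symbol y∈U)
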